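{- Let $p>q$ be odd primes with $p\equiv1\pmod q$, and let $G$ be the non-abelian group of order $pq$, given by generators $a,b$ with relations $a^q=b^p=e$ and $ba=ab^s$, where $s\not\equiv1$ and $s^q\equiv1\pmod p$. Then the saturated subsets of $G$ are all of the form $\{x,x^n\}$ with $x\in G$ and $n$ an integer.
   Context: For a group $S$, a subset $U\subseteq S$ is avoidable if there is a partition $\{A,B\}$ of $S$ such that no element of $U$ equals $xy$ with $x\neq y$ both in $A$ or both in $B$ (in either order). A subset is saturated if it is maximal with respect to inclusion among the avoidable subsets. -}

module Defs where

open import Data.Nat using (ℕ; zero; suc; _+_; _*_; _∸_; _^_; NonZero)
open import Data.Nat.DivMod using (_mod_)
open import Data.Fin using (Fin; toℕ)
open import Data.Integer using (ℤ; +_; -[1+_])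
open import Data.Product using (_×_; _,_; Σ; ∃)
open import Data.Sum using (_⊎_)
open import Data.Bool using (Bool; true)
open import Relation.Binary.PropositionalEquality using (_≡_; _≢_)
open import Relation.Nullary using (¬_)

-- The metacyclic group G = ⟨ a , b | a^q = b^p = e , b a = a b^s ⟩ of order p q,
-- realised concretely: the pair (i , j) stands for the element a^i b^j.
-- Since b^j a^k = a^k b^(j s^k), we get
--   (a^i b^j)(a^k b^l) = a^(i+k) b^(j s^k + l).
G : (q p : ℕ) → Set
G q p = Fin q × Fin p

module Grp (q p s : ℕ) .{{_ : NonZero q}} .{{_ : NonZero p}} where

  Carrier : Set
  Carrier = G q p

  e : Carrier
  e = (0 mod q , 0 mod p)

  a : Carrier
  a = (1 mod q , 0 mod p)

  b : Carrier
  b = (0 mod q , 1 mod p)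

  _·_ : Carrier → Carrier → Carrier
  (i , j) · (k , l) = ((toℕ i + toℕ k) mod q , (toℕ j * s ^ toℕ k + toℕ l) mod p)

  -- inverse of a^i b^j is a^(-i) b^(-j s^(-i)), using s^q ≡ 1 (mod p),
  -- so that s^(-i) = s^(q - i).
  inv : Carrier → Carrier
  inv (i , j) = ((q ∸ toℕ i) mod q , ((p ∸ toℕ j) * s ^ (q ∸ toℕ i)) mod p)

  _^ᴺ_ : Carrier → ℕ → Carrier
  x ^ᴺ zero = e
  x ^ᴺ suc n = x · (x ^ᴺ n)

  _^ᶻ_ : Carrier → ℤ → Carrier
  x ^ᶻ (+ n) = x ^ᴺ n
  x ^ᶻ -[1+ n ] = inv x ^ᴺ suc n

  Subset : Set
  Subset = Carrier → Bool

  _∈_ : Carrier → Subset → Set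
  x ∈ U = U x ≡ true

  _⊆_ : Subset → Subset → Set
  U ⊆ V = ∀ x → x ∈ U → x ∈ V

  -- A partition {A , B} of G is encoded by its indicator c : G → Bool
  -- (A = c⁻¹(true), B = c⁻¹(false)).
  Avoidable : Subset → Set
  Avoidable U = Σ (Carrier → Bool) λ c →
    ∀ x y → x ≢ y → c x ≡ c y → ¬ ((x · y) ∈ U)

  Saturated : Subset → Set
  Saturated U = Avoidable U × (∀ V → Avoidable V → U ⊆ V → V ⊆ U)

  IsPair : Subset → Carrier → ℤ → Set
  IsPair U x n = ∀ g → (g ∈ U → (g ≡ x ⊎ g ≡ x ^ᶻ n)) × ((g ≡ x ⊎ g ≡ x ^ᶻ n) → g ∈ U)

-- Since G has odd order, squaring is a bijection of G.  Hence for any u, v, w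
-- there are x, y, z with x y = u, y z = v, z x = w.  If u, v, w ∈ U and x, y, z
-- are pairwise distinct, then any 2-colouring gives two of x, y, z the same
-- colour, so U is not avoidable.
-- Taking (u , v , w) = (g , g , h) for non-commuting g, h, or three distinct
-- commuting elements, shows that an avoidable U consists of at most two
-- commuting elements.  Commuting elements of G generate a cyclic subgroup, so
-- one is a power of the other.  Finally a saturated U is nonempty, because {e}
-- is avoidable: colour x and x⁻¹ differently.
{-# OPTIONS --safe #-}
module Submission where

open import Algebra.Bundles using (Monoid; Group)
open import Algebra.Core using (Op₁; Op₂)
open import Algebra.Structures using (IsMonoid; IsGroup)
import Algebra.Properties.Group as GroupProperties
import Algebra.Properties.Monoid.Mult as MonoidMultiplication
open import Data.Bool using (Bool; true; not)
import Data.Bool.Properties as Bool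
open import Data.Empty using (⊥-elim)
open import Data.Fin using (Fin; toℕ; combine)
import Data.Fin.Properties as Fin
open import Data.Fin.Properties using (toℕ-injective; toℕ-fromℕ<; toℕ<n; combine-injective; any?)
open import Data.Integer using (ℤ; +_)
open import Data.Nat using (ℕ; zero; suc; _+_; _*_; _∸_; _<_; _<?_; _≟_; NonZero; ≢-nonZero; nonTrivial⇒n>1)
open import Data.Nat.Coprimality using (prime⇒coprime; coprime-Bézout)
import Data.Nat.Coprimality as Coprime
open import Data.Nat.DivMod
open import Data.Nat.GCD using (module Bézout)
open import Data.Nat.Primality using (Prime; prime⇒nonTrivial)
open import Data.Nat.Properties
  using (<-cmp; +-suc; +-comm; +-assoc; +-identityʳ; *-comm; *-assoc; *-identityˡ; *-identityʳ;
         suc-pred; ^-*-assoc; ^-zeroˡ; ^-distribˡ-+-*)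
open import Data.Nat.Tactic.RingSolver using (solve-∀)
open import Data.Product using (Σ; ∃; _×_; _,_; proj₁; proj₂; uncurry)
open import Data.Product.Properties using (≡-dec)
open import Data.Sum using (_⊎_; inj₁; inj₂)
import Data.Sum as Sum
open import Function using (_∘_; _on_; case_of_)
open import Function.Definitions using (Injective)
open import Level using (0ℓ)
open import Relation.Binary.Bundles using (Setoid)
import Relation.Binary.Construct.On as On
open import Relation.Binary.Definitions using (Decidable; DecidableEquality; tri<; tri≈; tri>)
open import Relation.Binary.PropositionalEquality
open import Relation.Binary.PropositionalEquality.Algebra using (isMagma)
import Relation.Binary.Reasoning.Setoid
open import Relation.Nullary using (¬_; Dec; yes; no; does; proof; Reflects; invert; contradiction)
open import Relation.Nullary.Decidable using (decidable-stable; dec-true; dec-false; map′; _×-dec_; ¬?)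

open import Defs

[m<?n]≡[n<?m]⇒m≡n : ∀ m n → does (m <? n) ≡ does (n <? m) → m ≡ n
[m<?n]≡[n<?m]⇒m≡n m n same with <-cmp m n
... | tri< m<n _ n≮m =
  contradiction (trans (sym (dec-true (m <? n) m<n)) (trans same (dec-false (n <? m) n≮m))) λ ()
... | tri≈ _ m≡n _   = m≡n
... | tri> m≮n _ n<m =
  contradiction (trans (sym (dec-false (m <? n) m≮n)) (trans same (dec-true (n <? m) n<m))) λ ()

module UniquelyTwoDivisible
  {A : Set} {_·_ : Op₂ A} {ε : A} {_⁻¹ : Op₁ A} (isGroup : IsGroup _≡_ _·_ ε _⁻¹)
  (√ : Op₁ A) (√-square : ∀ x → √ x · √ x ≡ x)
  (square-injective : ∀ {x y} → x · x ≡ y · y → x ≡ y)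
  where

  open IsGroup isGroup using (assoc; _//_; _\\_)

  group : Group 0ℓ 0ℓ
  group = record { isGroup = isGroup }

  open GroupProperties group
    using (∙-cancelˡ; ∙-cancelʳ; //-rightDividesˡ; //-rightDividesʳ; \\-leftDividesˡ; \\-leftDividesʳ;
           inverseˡ-unique; inverseʳ-unique)
  open ≡-Reasoning

  Commute : A → A → Set
  Commute x y = x · y ≡ y · x

  ·-commute : ∀ {a x y} → Commute a x → Commute a y → Commute a (x · y)
  ·-commute {a} {x} {y} ax ay = begin
    a · (x · y)  ≡⟨ assoc a x y ⟨
    (a · x) · y  ≡⟨ cong (_· y) ax ⟩
    (x · a) · y  ≡⟨ assoc x a y ⟩
    x · (a · y)  ≡⟨ cong (x ·_) ay ⟩
    x · (y · a)  ≡⟨ assoc x y a ⟨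
    (x · y) · a  ∎

  conjugate : A → A → A
  conjugate a x = a · x // a

  conjugate-· : ∀ a x y → conjugate a x · conjugate a y ≡ conjugate a (x · y)
  conjugate-· a x y = begin
    (a · x // a) · (a · y // a)    ≡⟨ assoc (a · x) (a ⁻¹) _ ⟩
    (a · x) · (a \\ (a · y // a))  ≡⟨ cong ((a · x) ·_) (assoc (a ⁻¹) (a · y) (a ⁻¹)) ⟨
    (a · x) · ((a \\ a · y) // a)  ≡⟨ cong (λ t → (a · x) · (t // a)) (\\-leftDividesʳ a y) ⟩
    (a · x) · (y // a)             ≡⟨ assoc (a · x) y (a ⁻¹) ⟨
    (a · x) · y // a               ≡⟨ cong (_// a) (assoc a x y) ⟩
    a · (x · y) // a               ∎

  commute⇒conjugate≡ : ∀ {a x} → Commute a x → conjugate a x ≡ x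
  commute⇒conjugate≡ {a} {x} ax = trans (cong (_// a) ax) (//-rightDividesʳ a x)

  conjugate≡⇒commute : ∀ {a x} → conjugate a x ≡ x → Commute a x
  conjugate≡⇒commute {a} {x} axa⁻¹≡x = begin
    a · x              ≡⟨ //-rightDividesˡ a (a · x) ⟨
    conjugate a x · a  ≡⟨ cong (_· a) axa⁻¹≡x ⟩
    x · a              ∎

  ⁻¹-commute : ∀ {a x} → Commute a x → Commute a (x ⁻¹)
  ⁻¹-commute {a} {x} ax = ∙-cancelˡ x _ _ (begin
    x · (a // x)  ≡⟨ assoc x a (x ⁻¹) ⟨
    x · a // x    ≡⟨ cong (_// x) ax ⟨
    a · x // x    ≡⟨ //-rightDividesʳ x a ⟩
    a             ≡⟨ \\-leftDividesˡ x a ⟨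
    x · (x \\ a)  ∎)

  square-commute⇒commute : ∀ {a x} → Commute a (x · x) → Commute a x
  square-commute⇒commute {a} {x} axx = conjugate≡⇒commute
    (square-injective (trans (conjugate-· a x x) (commute⇒conjugate≡ axx)))

  record Triangle (u v w : A) : Set where
    field
      x y z : A
      xy≡u : x · y ≡ u
      yz≡v : y · z ≡ v
      zx≡w : z · x ≡ w

    Proper : Set
    Proper = x ≢ y × y ≢ z × z ≢ x

  rotate : ∀ {u v w} → Triangle u v w → Triangle v w u
  rotate T = record { x = y ; y = z ; z = x ; xy≡u = yz≡v ; yz≡v = zx≡w ; zx≡w = xy≡u }
    where open Triangle T

  -- x is forced by (x · v) · (x · v) ≡ (u · w) · v; then y and z are forced by x.
  triangle : ∀ u v w → Triangle u v w
  triangle u v w = record { x = x ; y = y ; z = z ; xy≡u = xy≡u ; yz≡v = yz≡v ; zx≡w = zx≡w }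
    where
    r = √ ((u · w) · v)
    x = r // v
    y = x \\ u
    z = w // x
    xy≡u : x · y ≡ u
    xy≡u = \\-leftDividesˡ x u
    zx≡w : z · x ≡ w
    zx≡w = //-rightDividesˡ x w
    xvx≡uw : (x · v) · x ≡ u · w
    xvx≡uw = ∙-cancelʳ v _ _ (begin
      ((x · v) · x) · v  ≡⟨ assoc (x · v) x v ⟩
      (x · v) · (x · v)  ≡⟨ cong₂ _·_ (//-rightDividesˡ v r) (//-rightDividesˡ v r) ⟩
      r · r              ≡⟨ √-square _ ⟩
      (u · w) · v        ∎)
    yz≡v : y · z ≡ v
    yz≡v = ∙-cancelˡ x _ _ (∙-cancelʳ x _ _ (begin
      (x · (y · z)) · x  ≡⟨ cong (_· x) (assoc x y z) ⟨
      ((x · y) · z) · x  ≡⟨ assoc (x · y) z x ⟩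
      (x · y) · (z · x)  ≡⟨ cong₂ _·_ xy≡u zx≡w ⟩
      u · w              ≡⟨ xvx≡uw ⟨
      (x · v) · x        ∎))

  module Collapsed {u v w} (T : Triangle u v w) (x≡y : Triangle.x T ≡ Triangle.y T) where

    open Triangle T

    xx≡u : x · x ≡ u
    xx≡u = trans (cong (x ·_) x≡y) xy≡u

    xw≡vx : x · w ≡ v · x
    xw≡vx = begin
      x · w        ≡⟨ cong (x ·_) zx≡w ⟨
      x · (z · x)  ≡⟨ assoc x z x ⟨
      (x · z) · x  ≡⟨ cong (λ t → (t · z) · x) x≡y ⟩
      (y · z) · x  ≡⟨ cong (_· x) yz≡v ⟩
      v · x        ∎

    commute-x : ∀ {a} → Commute u a → Commute a x
    commute-x ua = square-commute⇒commute (subst (Commute _) (sym xx≡u) (sym ua))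

    commute-v⇒v≡w : Commute u v → v ≡ w
    commute-v⇒v≡w uv = ∙-cancelˡ x v w (trans (sym (commute-x uv)) (sym xw≡vx))

    commute-w⇒v≡w : Commute u w → v ≡ w
    commute-w⇒v≡w uw = ∙-cancelʳ x v w (trans (sym xw≡vx) (sym (commute-x uw)))

    v≡w⇒commute : v ≡ w → Commute u v
    v≡w⇒commute v≡w = subst (λ t → Commute t v) xx≡u (sym (·-commute vx vx))
      where
      vx : Commute v x
      vx = sym (trans (cong (x ·_) v≡w) xw≡vx)

  noncommuting-triangle-proper : ∀ {g h} → ¬ Commute g h → (T : Triangle g g h) → Triangle.Proper T
  noncommuting-triangle-proper {g} ¬gh T = x≢y , y≢z , z≢x
    where
    open Triangle T
    x≢y : x ≢ y
    x≢y x≡y = ¬gh (subst (Commute g) (Collapsed.commute-v⇒v≡w T x≡y refl) refl)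
    y≢z : y ≢ z
    y≢z y≡z = ¬gh (subst (Commute g) (sym (Collapsed.commute-w⇒v≡w (rotate T) y≡z refl)) refl)
    z≢x : z ≢ x
    z≢x z≡x = ¬gh (sym (Collapsed.v≡w⇒commute (rotate (rotate T)) z≡x refl))

  commuting-triangle-proper : ∀ {u v w} → Commute u v → Commute v w → Commute w u →
                              v ≢ w → w ≢ u → u ≢ v → (T : Triangle u v w) → Triangle.Proper T
  commuting-triangle-proper uv vw wu v≢w w≢u u≢v T =
      (λ x≡y → v≢w (Collapsed.commute-v⇒v≡w T x≡y uv))
    , (λ y≡z → w≢u (Collapsed.commute-v⇒v≡w (rotate T) y≡z vw))
    , (λ z≡x → u≢v (Collapsed.commute-v⇒v≡w (rotate (rotate T)) z≡x wu))

  -- Avoidable U in Defs is Σ c (Avoids c U) for the group G.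
  Avoids : (A → Bool) → (A → Bool) → Set
  Avoids c U = ∀ x y → x ≢ y → c x ≡ c y → ¬ (U (x · y) ≡ true)

  proper-triangle-unavoidable : ∀ {c U u v w} → Avoids c U →
                                U u ≡ true → U v ≡ true → U w ≡ true →
                                (T : Triangle u v w) → ¬ Triangle.Proper T
  proper-triangle-unavoidable {c} {U} avoids u∈U v∈U w∈U T (x≢y , y≢z , z≢x) =
    separated z≢x zx≡w w∈U
      (sym (trans (Bool.¬-not (separated x≢y xy≡u u∈U))
                  (trans (cong not (Bool.¬-not (separated y≢z yz≡v v∈U))) (Bool.not-involutive (c z)))))
    where
    open Triangle T
    separated : ∀ {a b g} → a ≢ b → a · b ≡ g → U g ≡ true → c a ≢ c b
    separated {a} {b} a≢b ab≡g g∈U ca≡cb =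
      avoids a b a≢b ca≡cb (subst (λ t → U t ≡ true) (sym ab≡g) g∈U)

  module _ (_≟_ : DecidableEquality A) {c U} (avoids : Avoids c U) where

    avoided⇒commute : ∀ {g h} → U g ≡ true → U h ≡ true → Commute g h
    avoided⇒commute {g} {h} g∈U h∈U = decidable-stable ((g · h) ≟ (h · g)) λ ¬gh →
      proper-triangle-unavoidable avoids g∈U g∈U h∈U T (noncommuting-triangle-proper ¬gh T)
      where T = triangle g g h

    avoided⇒at-most-two : ∀ {g h k} → U g ≡ true → U h ≡ true → U k ≡ true →
                          g ≢ h → k ≡ g ⊎ k ≡ h
    avoided⇒at-most-two {g} {h} {k} g∈U h∈U k∈U g≢h with k ≟ g | k ≟ h
    ... | yes k≡g | _       = inj₁ k≡g
    ... | no _    | yes k≡h = inj₂ k≡h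
    ... | no k≢g  | no k≢h  = contradiction (commuting-triangle-proper
            (avoided⇒commute g∈U h∈U) (avoided⇒commute h∈U k∈U) (avoided⇒commute k∈U g∈U)
            (k≢h ∘ sym) k≢g g≢h T) (proper-triangle-unavoidable avoids g∈U h∈U k∈U T)
      where T = triangle g h k

  module _ (key : A → ℕ) (key-injective : Injective _≡_ _≡_ key) where

    -- x and x ⁻¹ get different colours unless x ≡ x ⁻¹
    inverse-colouring : A → Bool
    inverse-colouring x = does (key x <? key (x ⁻¹))

    inverse-colouring-avoids-ε : ∀ x y → x ≢ y → inverse-colouring x ≡ inverse-colouring y → x · y ≢ ε
    inverse-colouring-avoids-ε x y x≢y same xy≡ε =
      x≢y (key-injective ([m<?n]≡[n<?m]⇒m≡n (key x) (key y) (begin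
        does (key x <? key y)  ≡⟨ cong (λ t → does (key x <? key t)) (inverseʳ-unique x y xy≡ε) ⟩
        inverse-colouring x    ≡⟨ same ⟩
        inverse-colouring y    ≡⟨ cong (λ t → does (key y <? key t)) (inverseˡ-unique x y xy≡ε) ⟨
        does (key y <? key x)  ∎)))

module MonoidPower {A : Set} {_·_ : Op₂ A} {ε : A} (isMonoid : IsMonoid _≡_ _·_ ε) where

  open IsMonoid isMonoid using (assoc; identityˡ; identityʳ)
  open ≡-Reasoning

  private
    monoid : Monoid 0ℓ 0ℓ
    monoid = record { isMonoid = isMonoid }

    module Power = MonoidMultiplication monoid

  infix 30 _^_
  _^_ : A → ℕ → A
  x ^ n = n Power.× x

  ^-+ : ∀ x m n → x ^ (m + n) ≡ (x ^ m) · (x ^ n)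
  ^-+ x = Power.×-homo-+ x

  ^-* : ∀ x m n → x ^ (m * n) ≡ (x ^ n) ^ m
  ^-* x m n = sym (Power.×-assocˡ x m n)

  ^-commute : ∀ {a x} n → a · x ≡ x · a → a · (x ^ n) ≡ (x ^ n) · a
  ^-commute {a} zero    ax = trans (identityʳ a) (sym (identityˡ a))
  ^-commute {a} {x} (suc n) ax = begin
    a · (x · (x ^ n))  ≡⟨ assoc a x (x ^ n) ⟨
    (a · x) · (x ^ n)  ≡⟨ cong (_· (x ^ n)) ax ⟩
    (x · a) · (x ^ n)  ≡⟨ assoc x a (x ^ n) ⟩
    x · (a · (x ^ n))  ≡⟨ cong (x ·_) (^-commute n ax) ⟩
    x · ((x ^ n) · a)  ≡⟨ assoc x (x ^ n) a ⟨
    (x · (x ^ n)) · a  ∎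

module OddExponent
  {A : Set} {_·_ : Op₂ A} {ε : A} (isMonoid : IsMonoid _≡_ _·_ ε)
  (t : ℕ) (x^[2t+1]≡ε : ∀ x → MonoidPower._^_ isMonoid x (suc (t + t)) ≡ ε)
  where

  open IsMonoid isMonoid using (identityʳ)
  open MonoidPower isMonoid using (_^_; ^-+; ^-*; ^-commute)
  open ≡-Reasoning

  _⁻¹ : A → A
  x ⁻¹ = x ^ (t + t)

  isGroup : IsGroup _≡_ _·_ ε _⁻¹
  isGroup = record
    { isMonoid = isMonoid
    ; inverse  = (λ x → trans (sym (^-commute (t + t) refl)) (x^[2t+1]≡ε x)) , x^[2t+1]≡ε
    ; ⁻¹-cong  = cong _⁻¹
    }

  √ : A → A
  √ x = x ^ suc t

  √-square : ∀ x → √ x · √ x ≡ x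
  √-square x = begin
    √ x · √ x                   ≡⟨ ^-+ x (suc t) (suc t) ⟨
    x ^ (suc t + suc t)         ≡⟨ cong (λ n → x ^ suc n) (+-suc t t) ⟩
    x · (x ^ suc (t + t))       ≡⟨ cong (x ·_) (x^[2t+1]≡ε x) ⟩
    x · ε                       ≡⟨ identityʳ x ⟩
    x                           ∎

  √-of-square : ∀ x → √ (x · x) ≡ x
  √-of-square x = begin
    (x · x) ^ suc t             ≡⟨ cong (λ y → (x · y) ^ suc t) (identityʳ x) ⟨
    (x ^ 2) ^ suc t             ≡⟨ ^-* x (suc t) 2 ⟨
    x ^ (suc t * 2)             ≡⟨ cong (x ^_) (*-comm (suc t) 2) ⟩
    x ^ (suc t + (suc t + 0))   ≡⟨ cong (λ n → x ^ (suc t + n)) (+-identityʳ (suc t)) ⟩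
    x ^ (suc t + suc t)         ≡⟨ ^-+ x (suc t) (suc t) ⟩
    √ x · √ x                   ≡⟨ √-square x ⟩
    x                           ∎

  square-injective : ∀ {x y} → x · x ≡ y · y → x ≡ y
  square-injective {x} {y} xx≡yy = begin
    x             ≡⟨ √-of-square x ⟨
    √ (x · x)     ≡⟨ cong √ xx≡yy ⟩
    √ (y · y)     ≡⟨ √-of-square y ⟩
    y             ∎

-- Imported only here, as the monoid power above is also written _^_.
open import Data.Nat using (_^_)

module Modulo (d : ℕ) .{{_ : NonZero d}} where

  -- _≈_ unfolds to an equation between remainders, from which Agda cannot
  -- infer its arguments; hence the explicit implicit arguments below.
  infix 4 _≈_
  _≈_ : ℕ → ℕ → Set
  _≈_ = _≡_ on (_% d)

  ≈-setoid : Setoid 0ℓ 0ℓ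
  ≈-setoid = On.setoid (setoid ℕ) (_% d)

  open Setoid ≈-setoid public using () renaming (refl to ≈-refl; sym to ≈-sym; trans to ≈-trans)
  module ≈-Reasoning = Relation.Binary.Reasoning.Setoid ≈-setoid

  %-≈ : ∀ m → m % d ≈ m
  %-≈ m = m%n%n≡m%n m d

  ≡⇒≈ : ∀ {m n} → m ≡ n → m ≈ n
  ≡⇒≈ = cong (_% d)

  *d≈0 : ∀ k → k * d ≈ 0
  *d≈0 k = trans (m*n%n≡0 k d) (sym (m*n%n≡0 0 d))

  d*≈0 : ∀ k → d * k ≈ 0
  d*≈0 k = trans (cong (_% d) (*-comm d k)) (*d≈0 k)

  +-cong : ∀ {m m′ n n′} → m ≈ m′ → n ≈ n′ → m + n ≈ m′ + n′
  +-cong {m} {m′} {n} {n′} m≈m′ n≈n′ = begin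
    (m + n) % d              ≡⟨ %-distribˡ-+ m n d ⟩
    (m % d + n % d) % d      ≡⟨ cong₂ (λ a b → (a + b) % d) m≈m′ n≈n′ ⟩
    (m′ % d + n′ % d) % d    ≡⟨ %-distribˡ-+ m′ n′ d ⟨
    (m′ + n′) % d            ∎
    where open ≡-Reasoning

  *-cong : ∀ {m m′ n n′} → m ≈ m′ → n ≈ n′ → m * n ≈ m′ * n′
  *-cong {m} {m′} {n} {n′} m≈m′ n≈n′ = begin
    (m * n) % d              ≡⟨ %-distribˡ-* m n d ⟩
    (m % d * (n % d)) % d    ≡⟨ cong₂ (λ a b → (a * b) % d) m≈m′ n≈n′ ⟩
    (m′ % d * (n′ % d)) % d  ≡⟨ %-distribˡ-* m′ n′ d ⟨
    (m′ * n′) % d            ∎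
    where open ≡-Reasoning

  ^-congˡ : ∀ {m n} → m ≈ n → ∀ k → m ^ k ≈ n ^ k
  ^-congˡ m≈n zero    = refl
  ^-congˡ m≈n (suc k) = *-cong m≈n (^-congˡ m≈n k)

  -- adding (d ∸ 1) * k is subtracting k
  +-cancelʳ : ∀ m n k → m + k ≈ n + k → m ≈ n
  +-cancelʳ m n k m+k≈n+k = begin
    m                          ≈⟨ cancel-k m ⟨
    (m + k) + (d ∸ 1) * k      ≈⟨ +-cong m+k≈n+k ≈-refl ⟩
    (n + k) + (d ∸ 1) * k      ≈⟨ cancel-k n ⟩
    n                          ∎
    where
    open ≈-Reasoning
    cancel-k : ∀ a → (a + k) + (d ∸ 1) * k ≈ a
    cancel-k a = ≈-trans (≡⇒≈ (trans (regroup a k (d ∸ 1)) (cong (λ e → a + k * e) (suc-pred d))))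
                       ([m+kn]%n≡m%n a k d)
      where
      regroup : ∀ a k e → (a + k) + e * k ≡ a + k * suc e
      regroup = solve-∀

  +-cancelˡ : ∀ k m n → k + m ≈ k + n → m ≈ n
  +-cancelˡ k m n k+m≈k+n = +-cancelʳ m n k (trans (≡⇒≈ (+-comm m k)) (trans k+m≈k+n (≡⇒≈ (+-comm k n))))

  ^-≈1 : ∀ {a n} → a ^ n ≈ 1 → ∀ m → a ^ (m * n) ≈ 1
  ^-≈1 {a} {n} aⁿ≈1 m = begin
    a ^ (m * n)    ≡⟨ cong (a ^_) (*-comm m n) ⟩
    a ^ (n * m)    ≡⟨ ^-*-assoc a n m ⟨
    (a ^ n) ^ m    ≈⟨ ^-congˡ aⁿ≈1 m ⟩
    1 ^ m          ≡⟨ ^-zeroˡ m ⟩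
    1              ∎
    where open ≈-Reasoning

  _≈?_ : Decidable _≈_
  m ≈? n = m % d ≟ n % d

  toℕ-mod≡% : ∀ m → toℕ (m mod d) ≡ m % d
  toℕ-mod≡% m = toℕ-fromℕ< (m%n<n m d)

  toℕ-mod : ∀ m → toℕ (m mod d) ≈ m
  toℕ-mod m = trans (cong (_% d) (toℕ-mod≡% m)) (%-≈ m)

  mod-cong : ∀ {m n} → m ≈ n → m mod d ≡ n mod d
  mod-cong m≈n = toℕ-injective (trans (toℕ-fromℕ< _) (trans m≈n (sym (toℕ-fromℕ< _))))

  mod-injective : ∀ {m n} → m mod d ≡ n mod d → m ≈ n
  mod-injective {m} {n} eq = trans (sym (toℕ-fromℕ< _)) (trans (cong toℕ eq) (toℕ-fromℕ< _))

  toℕ-mod-id : ∀ (i : Fin d) → toℕ i mod d ≡ i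
  toℕ-mod-id i = toℕ-injective (trans (toℕ-fromℕ< _) (m<n⇒m%n≡m (toℕ<n i)))

  toℕ≈0⇒≡0 : ∀ (i : Fin d) → toℕ i ≈ 0 → toℕ i ≡ 0
  toℕ≈0⇒≡0 i i≈0 = trans (sym (m<n⇒m%n≡m (toℕ<n i))) (trans i≈0 (m*n%n≡0 0 d))

  ≉0⇒%-nonZero : ∀ {m} → ¬ (m ≈ 0) → NonZero (m % d)
  ≉0⇒%-nonZero m≉0 = ≢-nonZero λ m%d≡0 → m≉0 (trans m%d≡0 (sym (m*n%n≡0 0 d)))

  module _ (d-prime : Prime d) where

    inverse : ∀ {a} → ¬ (a ≈ 0) → ∃ λ u → u * a ≈ 1
    inverse {a} a≉0 = let u , ua%d≈1 = residue-inverse in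
      u , ≈-trans (*-cong (≈-refl {u}) (≈-sym (%-≈ a))) ua%d≈1
      where
      residue-inverse : ∃ λ u → u * (a % d) ≈ 1
      residue-inverse with coprime-Bézout (Coprime.sym
                             (prime⇒coprime d-prime {{≉0⇒%-nonZero a≉0}} (m%n<n a d)))
      ... | Bézout.+- x y eq = x , ≈-trans (≡⇒≈ (sym eq)) ([m+kn]%n≡m%n 1 y d)
      -- here x * (a % d) ≈ -1, so (d ∸ 1) * x is the inverse
      ... | Bézout.-+ x y eq = (d ∸ 1) * x , +-cancelʳ _ 1 (d ∸ 1) (begin
        (d ∸ 1) * x * (a % d) + (d ∸ 1)  ≡⟨ regroup (d ∸ 1) x (a % d) ⟩
        (d ∸ 1) * (1 + x * (a % d))      ≡⟨ cong ((d ∸ 1) *_) eq ⟩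
        (d ∸ 1) * (y * d)                ≡⟨ *-assoc (d ∸ 1) y d ⟨
        (d ∸ 1) * y * d                  ≈⟨ *d≈0 ((d ∸ 1) * y) ⟩
        0                                ≈⟨ *d≈0 1 ⟨
        1 * d                            ≡⟨ trans (*-identityˡ d) (sym (suc-pred d)) ⟩
        1 + (d ∸ 1)                      ∎)
        where
        open ≈-Reasoning
        regroup : ∀ e x a → e * x * a + e ≡ e * (1 + x * a)
        regroup = solve-∀

    *-cancelˡ : ∀ {a m n} → ¬ (a ≈ 0) → a * m ≈ a * n → m ≈ n
    *-cancelˡ {a} {m} {n} a≉0 am≈an with u , ua≈1 ← inverse a≉0 = begin
      m            ≡⟨ *-identityˡ m ⟨
      1 * m        ≈⟨ *-cong ua≈1 (≈-refl {m}) ⟨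
      u * a * m    ≡⟨ *-assoc u a m ⟩
      u * (a * m)  ≈⟨ *-cong (≈-refl {u}) am≈an ⟩
      u * (a * n)  ≡⟨ *-assoc u a n ⟨
      u * a * n    ≈⟨ *-cong ua≈1 (≈-refl {n}) ⟩
      1 * n        ≡⟨ *-identityˡ n ⟩
      n            ∎
      where open ≈-Reasoning

    solve-linear : ∀ {a} → ¬ (a ≈ 0) → ∀ k → ∃ λ n → n * a ≈ k
    solve-linear {a} a≉0 k with u , ua≈1 ← inverse a≉0 = u * k , (begin
      u * k * a    ≡⟨ *-assoc u k a ⟩
      u * (k * a)  ≡⟨ cong (u *_) (*-comm k a) ⟩
      u * (a * k)  ≡⟨ *-assoc u a k ⟨
      u * a * k    ≈⟨ *-cong ua≈1 (≈-refl {k}) ⟩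
      1 * k        ≡⟨ *-identityˡ k ⟩
      k            ∎)
      where open ≈-Reasoning

odd⇒≡suc[half+half] : ∀ n → n % 2 ≡ 1 → n ≡ suc (n / 2 + n / 2)
odd⇒≡suc[half+half] n n%2≡1 = trans (m≡m%n+[m/n]*n n 2) (cong₂ _+_ n%2≡1 (double (n / 2)))
  where
  double : ∀ m → m * 2 ≡ m + m
  double = solve-∀

module Metacyclic
  (p q s : ℕ) .{{_ : NonZero p}} .{{_ : NonZero q}}
  (p-prime : Prime p) (q-prime : Prime q) (p-odd : p % 2 ≡ 1) (q-odd : q % 2 ≡ 1)
  (s≢1 : s % p ≢ 1) (s^q≡1 : (s ^ q) % p ≡ 1)
  where

  open Grp q p s
  module P = Modulo p
  module Q = Modulo q

  1<p : 1 < p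
  1<p = nonTrivial⇒n>1 p {{prime⇒nonTrivial p-prime}}

  s^q≈1 : s ^ q P.≈ 1
  s^q≈1 = trans s^q≡1 (sym (m<n⇒m%n≡m 1<p))

  s^-mod : ∀ k → s ^ (k % q) P.≈ s ^ k
  s^-mod k = P.≈-sym (begin
    s ^ k                            ≡⟨ cong (s ^_) (m≡m%n+[m/n]*n k q) ⟩
    s ^ (k % q + k / q * q)          ≡⟨ ^-distribˡ-+-* s (k % q) _ ⟩
    s ^ (k % q) * s ^ (k / q * q)    ≈⟨ P.*-cong (P.≈-refl {s ^ (k % q)}) (P.^-≈1 {s} {q} s^q≈1 (k / q)) ⟩
    s ^ (k % q) * 1                  ≡⟨ *-identityʳ _ ⟩
    s ^ (k % q)                      ∎)
    where open P.≈-Reasoning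

  s^k≈1⇒k≈0 : ∀ k → s ^ k P.≈ 1 → k Q.≈ 0
  s^k≈1⇒k≈0 k s^k≈1 = decidable-stable (k Q.≈? 0) λ k≉0 →
    s≢1 (trans (s≈1 k≉0) (m<n⇒m%n≡m 1<p))
    where
    s^[1+m]≈s : ∀ {m} → s ^ m P.≈ 1 → s ^ suc m P.≈ s
    s^[1+m]≈s {m} sᵐ≈1 = P.≈-trans (P.*-cong (P.≈-refl {s}) sᵐ≈1) (P.≡⇒≈ (*-identityʳ s))
    1+m≡n⇒s≈1 : ∀ {m n} → 1 + m ≡ n → s ^ m P.≈ 1 → s ^ n P.≈ 1 → s P.≈ 1
    1+m≡n⇒s≈1 {m} refl sᵐ≈1 sⁿ≈1 = P.≈-trans (P.≈-sym (s^[1+m]≈s {m} sᵐ≈1)) sⁿ≈1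
    s^[k%q]≈1 : s ^ (k % q) P.≈ 1
    s^[k%q]≈1 = P.≈-trans (s^-mod k) s^k≈1
    s≈1 : ¬ (k Q.≈ 0) → s P.≈ 1
    s≈1 k≉0 with coprime-Bézout (Coprime.sym
                   (prime⇒coprime q-prime {{Q.≉0⇒%-nonZero k≉0}} (m%n<n k q)))
    ... | Bézout.+- x y eq = 1+m≡n⇒s≈1 eq (P.^-≈1 {s} {q} s^q≈1 y) (P.^-≈1 {s} {k % q} s^[k%q]≈1 x)
    ... | Bézout.-+ x y eq = 1+m≡n⇒s≈1 eq (P.^-≈1 {s} {k % q} s^[k%q]≈1 x) (P.^-≈1 {s} {q} s^q≈1 y)

  infix 30 a^_b^_
  a^_b^_ : ℕ → ℕ → Carrier
  a^ i b^ j = (i mod q , j mod p)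

  a-exp : Carrier → ℕ
  a-exp = toℕ ∘ proj₁

  b-exp : Carrier → ℕ
  b-exp = toℕ ∘ proj₂

  a^b^-exp : ∀ x → a^ a-exp x b^ b-exp x ≡ x
  a^b^-exp (i , j) = cong₂ _,_ (Q.toℕ-mod-id i) (P.toℕ-mod-id j)

  a^b^-elim : {Φ : Carrier → Set} → (∀ i j → Φ (a^ i b^ j)) → ∀ x → Φ x
  a^b^-elim {Φ} Φ-a^b^ x = subst Φ (a^b^-exp x) (Φ-a^b^ (a-exp x) (b-exp x))

  a^b^-cong : ∀ {i i′ j j′} → i Q.≈ i′ → j P.≈ j′ → a^ i b^ j ≡ a^ i′ b^ j′
  a^b^-cong i≈i′ j≈j′ = cong₂ _,_ (Q.mod-cong i≈i′) (P.mod-cong j≈j′)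

  a^b^-injective : ∀ {i i′ j j′} → a^ i b^ j ≡ a^ i′ b^ j′ → i Q.≈ i′ × j P.≈ j′
  a^b^-injective eq = Q.mod-injective (cong proj₁ eq) , P.mod-injective (cong proj₂ eq)

  ·-a^b^ : ∀ i j k l → a^ i b^ j · a^ k b^ l ≡ a^ (i + k) b^ (j * s ^ k + l)
  ·-a^b^ i j k l = a^b^-cong (Q.+-cong (Q.toℕ-mod i) (Q.toℕ-mod k))
    (P.+-cong (P.*-cong (P.toℕ-mod j) s^[k-mod-q]≈s^k) (P.toℕ-mod l))
    where
    s^[k-mod-q]≈s^k : s ^ toℕ (k mod q) P.≈ s ^ k
    s^[k-mod-q]≈s^k = begin
      s ^ toℕ (k mod q)  ≡⟨ cong (s ^_) (Q.toℕ-mod≡% k) ⟩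
      s ^ (k % q)        ≈⟨ s^-mod k ⟩
      s ^ k              ∎
      where open P.≈-Reasoning

  ·-assoc : ∀ x y z → (x · y) · z ≡ x · (y · z)
  ·-assoc = a^b^-elim λ i j → a^b^-elim λ k l → a^b^-elim λ m n → begin
    (a^ i b^ j · a^ k b^ l) · a^ m b^ n                ≡⟨ cong (_· a^ m b^ n) (·-a^b^ i j k l) ⟩
    a^ (i + k) b^ (j * s ^ k + l) · a^ m b^ n          ≡⟨ ·-a^b^ (i + k) _ m n ⟩
    a^ (i + k + m) b^ ((j * s ^ k + l) * s ^ m + n)    ≡⟨ cong₂ a^_b^_ (+-assoc i k m) (regroup j k l m n) ⟩
    a^ (i + (k + m)) b^ (j * s ^ (k + m) + (l * s ^ m + n)) ≡⟨ ·-a^b^ i j (k + m) _ ⟨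
    a^ i b^ j · a^ (k + m) b^ (l * s ^ m + n)          ≡⟨ cong (a^ i b^ j ·_) (·-a^b^ k l m n) ⟨
    a^ i b^ j · (a^ k b^ l · a^ m b^ n)                ∎
    where
    open ≡-Reasoning
    regroup : ∀ j k l m n → (j * s ^ k + l) * s ^ m + n ≡ j * s ^ (k + m) + (l * s ^ m + n)
    regroup j k l m n = trans (semiring j (s ^ k) (s ^ m) l n)
                              (cong (λ t → j * t + (l * s ^ m + n)) (sym (^-distribˡ-+-* s k m)))
      where
      semiring : ∀ j x y l n → (j * x + l) * y + n ≡ j * (x * y) + (l * y + n)
      semiring = solve-∀

  ·-identityˡ : ∀ x → e · x ≡ x
  ·-identityˡ = a^b^-elim (·-a^b^ 0 0)

  ·-identityʳ : ∀ x → x · e ≡ x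
  ·-identityʳ = a^b^-elim λ i j →
    trans (·-a^b^ i j 0 0) (cong₂ a^_b^_ (+-identityʳ i) (trans (+-identityʳ (j * 1)) (*-identityʳ j)))

  ·-isMonoid : IsMonoid _≡_ _·_ e
  ·-isMonoid = record
    { isSemigroup = record { isMagma = isMagma _·_ ; assoc = ·-assoc }
    ; identity    = ·-identityˡ , ·-identityʳ
    }

  open MonoidPower ·-isMonoid using (^-*; ^-commute) renaming (_^_ to _^ᴳ_)

  a-exp-· : ∀ x y → a-exp (x · y) Q.≈ a-exp x + a-exp y
  a-exp-· x y = Q.toℕ-mod _

  a-exp-^ : ∀ x n → a-exp (x ^ᴳ n) Q.≈ n * a-exp x
  a-exp-^ x zero    = Q.toℕ-mod 0
  a-exp-^ x (suc n) = begin
    a-exp (x · x ^ᴳ n)        ≈⟨ a-exp-· x (x ^ᴳ n) ⟩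
    a-exp x + a-exp (x ^ᴳ n)  ≈⟨ Q.+-cong (Q.≈-refl {a-exp x}) (a-exp-^ x n) ⟩
    a-exp x + n * a-exp x     ∎
    where open Q.≈-Reasoning

  a-exp≈0⇒b^ : ∀ x → a-exp x Q.≈ 0 → x ≡ a^ 0 b^ b-exp x
  a-exp≈0⇒b^ x a-exp≈0 =
    trans (sym (a^b^-exp x)) (cong (λ i → a^ i b^ b-exp x) (Q.toℕ≈0⇒≡0 (proj₁ x) a-exp≈0))

  b^-^ : ∀ j n → (a^ 0 b^ j) ^ᴳ n ≡ a^ 0 b^ (n * j)
  b^-^ j zero    = refl
  b^-^ j (suc n) = begin
    a^ 0 b^ j · (a^ 0 b^ j) ^ᴳ n  ≡⟨ cong (a^ 0 b^ j ·_) (b^-^ j n) ⟩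
    a^ 0 b^ j · a^ 0 b^ (n * j)   ≡⟨ ·-a^b^ 0 j 0 (n * j) ⟩
    a^ 0 b^ (j * 1 + n * j)       ≡⟨ cong (λ i → a^ 0 b^ (i + n * j)) (*-identityʳ j) ⟩
    a^ 0 b^ (j + n * j)           ∎
    where open ≡-Reasoning

  -- x ^ q lies in the normal subgroup ⟨b⟩, of order p
  x^[pq]≡e : ∀ x → x ^ᴳ (p * q) ≡ e
  x^[pq]≡e x = begin
    x ^ᴳ (p * q)          ≡⟨ ^-* x p q ⟩
    (x ^ᴳ q) ^ᴳ p         ≡⟨ cong (_^ᴳ p) (a-exp≈0⇒b^ (x ^ᴳ q) x^q∈⟨b⟩) ⟩
    (a^ 0 b^ j) ^ᴳ p      ≡⟨ b^-^ j p ⟩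
    a^ 0 b^ (p * j)       ≡⟨ a^b^-cong (Q.≈-refl {0}) (P.d*≈0 j) ⟩
    e                     ∎
    where
    open ≡-Reasoning
    j = b-exp (x ^ᴳ q)
    x^q∈⟨b⟩ : a-exp (x ^ᴳ q) Q.≈ 0
    x^q∈⟨b⟩ = Q.≈-trans (a-exp-^ x q) (Q.d*≈0 (a-exp x))

  t : ℕ
  t = p * q / 2

  x^[2t+1]≡e : ∀ x → x ^ᴳ suc (t + t) ≡ e
  x^[2t+1]≡e x = subst (λ n → x ^ᴳ n ≡ e) pq≡suc[t+t] (x^[pq]≡e x)
    where
    pq≡suc[t+t] : p * q ≡ suc (t + t)
    pq≡suc[t+t] = odd⇒≡suc[half+half] (p * q)
      (trans (%-distribˡ-* p q 2) (cong₂ (λ m n → (m * n) % 2) p-odd q-odd))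

  open OddExponent ·-isMonoid t x^[2t+1]≡e using (isGroup; √; √-square; square-injective)
  open UniquelyTwoDivisible isGroup √ √-square square-injective public
  open IsGroup isGroup using (_\\_)
  open GroupProperties group using (\\-leftDividesˡ)

  _∈⟨_⟩ : Carrier → Carrier → Set
  h ∈⟨ g ⟩ = ∃ λ n → h ≡ g ^ᴳ n

  -- b^j · a^k = a^k · b^(j s^k), so commuting forces j s^k ≈ j, while s^k ≉ 1.
  commute-b^⇒b^≈0 : ∀ j k l → ¬ (k Q.≈ 0) → Commute (a^ 0 b^ j) (a^ k b^ l) → j P.≈ 0
  commute-b^⇒b^≈0 j k l k≉0 commute = decidable-stable (j P.≈? 0) λ j≉0 →
    k≉0 (s^k≈1⇒k≈0 k (P.*-cancelˡ p-prime {j} {s ^ k} {1} j≉0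
                        (P.+-cancelʳ (j * s ^ k) (j * 1) l js^k+l≈j+l)))
    where
    js^k+l≈j+l : j * s ^ k + l P.≈ j * 1 + l
    js^k+l≈j+l = begin
      j * s ^ k + l  ≈⟨ proj₂ (a^b^-injective (trans (sym (·-a^b^ 0 j k l)) (trans commute (·-a^b^ k l 0 j)))) ⟩
      l * 1 + j      ≡⟨ +-comm (l * 1) j ⟩
      j + l * 1      ≡⟨ cong₂ _+_ (sym (*-identityʳ j)) (*-identityʳ l) ⟩
      j * 1 + l      ∎
      where open P.≈-Reasoning

  -- For n with a-exp (g ^ n) ≈ a-exp h, (g ^ n) \\ h lies in ⟨b⟩ and commutes with g ∉ ⟨b⟩.
  commute⇒∈⟨⟩ : ∀ {g h} → ¬ (a-exp g Q.≈ 0) → Commute g h → h ∈⟨ g ⟩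
  commute⇒∈⟨⟩ {g} {h} g∉⟨b⟩ gh with n , ng≈h ← Q.solve-linear q-prime g∉⟨b⟩ (a-exp h) =
    n , sym gⁿ≡h
    where
    x = g ^ᴳ n
    δ = x \\ h
    a-exp-δ≈0 : a-exp δ Q.≈ 0
    a-exp-δ≈0 = Q.+-cancelˡ (a-exp x) (a-exp δ) 0 (begin
      a-exp x + a-exp δ  ≈⟨ a-exp-· x δ ⟨
      a-exp (x · δ)      ≡⟨ cong a-exp (\\-leftDividesˡ x h) ⟩
      a-exp h            ≈⟨ ng≈h ⟨
      n * a-exp g        ≈⟨ a-exp-^ g n ⟨
      a-exp x            ≡⟨ +-identityʳ (a-exp x) ⟨
      a-exp x + 0        ∎)
      where open Q.≈-Reasoning
    gδ : Commute g δ
    gδ = ·-commute (⁻¹-commute (^-commute n refl)) gh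
    δ≡e : δ ≡ e
    δ≡e = trans (a-exp≈0⇒b^ δ a-exp-δ≈0) (a^b^-cong (Q.≈-refl {0})
      (commute-b^⇒b^≈0 (b-exp δ) (a-exp g) (b-exp g) g∉⟨b⟩
        (subst₂ Commute (a-exp≈0⇒b^ δ a-exp-δ≈0) (sym (a^b^-exp g)) (sym gδ))))
    gⁿ≡h : x ≡ h
    gⁿ≡h = trans (sym (·-identityʳ x)) (trans (cong (x ·_) (sym δ≡e)) (\\-leftDividesˡ x h))

  b^-∈⟨⟩ : ∀ j l → a^ 0 b^ l ∈⟨ a^ 0 b^ j ⟩ ⊎ a^ 0 b^ j ∈⟨ a^ 0 b^ l ⟩
  b^-∈⟨⟩ j l with j P.≈? 0
  ... | yes j≈0 = inj₂ (0 , a^b^-cong (Q.≈-refl {0}) j≈0)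
  ... | no j≉0 with n , nj≈l ← P.solve-linear p-prime j≉0 l =
    inj₁ (n , sym (trans (b^-^ j n) (a^b^-cong (Q.≈-refl {0}) nj≈l)))

  commute⇒∈⟨⟩⊎∈⟨⟩ : ∀ g h → Commute g h → h ∈⟨ g ⟩ ⊎ g ∈⟨ h ⟩
  commute⇒∈⟨⟩⊎∈⟨⟩ g h gh with a-exp g Q.≈? 0 | a-exp h Q.≈? 0
  ... | no g∉⟨b⟩ | _         = inj₁ (commute⇒∈⟨⟩ g∉⟨b⟩ gh)
  ... | yes _    | no h∉⟨b⟩  = inj₂ (commute⇒∈⟨⟩ h∉⟨b⟩ (sym gh))
  ... | yes g∈⟨b⟩ | yes h∈⟨b⟩ =
    subst₂ (λ g h → h ∈⟨ g ⟩ ⊎ g ∈⟨ h ⟩) (sym (a-exp≈0⇒b^ g g∈⟨b⟩)) (sym (a-exp≈0⇒b^ h h∈⟨b⟩))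
      (b^-∈⟨⟩ (b-exp g) (b-exp h))

  infix 4 _≟ᴳ_
  _≟ᴳ_ : DecidableEquality Carrier
  _≟ᴳ_ = ≡-dec Fin._≟_ Fin._≟_

  ∃? : {Φ : Carrier → Set} → (∀ x → Dec (Φ x)) → Dec (∃ Φ)
  ∃? Φ? = map′ (λ (i , j , Φij) → (i , j) , Φij) (λ ((i , j) , Φij) → i , j , Φij)
               (any? λ i → any? λ j → Φ? (i , j))

  key : Carrier → ℕ
  key (i , j) = toℕ (combine i j)

  key-injective : Injective _≡_ _≡_ key
  key-injective {i , j} {k , l} eq = uncurry (cong₂ _,_) (combine-injective i j k l (toℕ-injective eq))

  singleton-e : Subset
  singleton-e x = does (x ≟ᴳ e)

  ∈singleton-e⇒≡e : ∀ x → x ∈ singleton-e → x ≡ e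
  ∈singleton-e⇒≡e x x∈ = invert (subst (Reflects (x ≡ e)) x∈ (proof (x ≟ᴳ e)))

  singleton-e-avoidable : Avoidable singleton-e
  singleton-e-avoidable = inverse-colouring key key-injective , λ x y x≢y same xy≡e →
    inverse-colouring-avoids-ε key key-injective x y x≢y same (∈singleton-e⇒≡e (x · y) xy≡e)

  saturated⇒nonempty : ∀ {U} → Saturated U → ∃ (_∈ U)
  saturated⇒nonempty {U} (_ , maximal) = decidable-stable (∃? λ x → U x Bool.≟ true) λ U≡∅ →
    U≡∅ (e , maximal singleton-e singleton-e-avoidable (λ x x∈U → ⊥-elim (U≡∅ (x , x∈U))) e
                     (dec-true (e ≟ᴳ e) refl))

  ^ᴺ≡^ᴳ : ∀ x n → x ^ᴺ n ≡ x ^ᴳ n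
  ^ᴺ≡^ᴳ x zero    = refl
  ^ᴺ≡^ᴳ x (suc n) = cong (x ·_) (^ᴺ≡^ᴳ x n)

  is-pair : ∀ {U x y n} → x ∈ U → y ∈ U → (∀ k → k ∈ U → k ≡ x ⊎ k ≡ y) → y ≡ x ^ᴳ n →
            IsPair U x (+ n)
  is-pair {U} {x} {y} {n} x∈U y∈U U⊆x,y y≡xⁿ k =
      (λ k∈U → Sum.map₂ (λ k≡y → trans k≡y y≡xⁿ′) (U⊆x,y k k∈U))
    , Sum.[ (λ { refl → x∈U }) , (λ { refl → subst (_∈ U) y≡xⁿ′ y∈U }) ]
    where
    y≡xⁿ′ : y ≡ x ^ᴺ n
    y≡xⁿ′ = trans y≡xⁿ (sym (^ᴺ≡^ᴳ x n))

  two-elements⇒pair : ∀ {U g h} → Avoidable U → g ∈ U → h ∈ U → h ≢ g →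
                      Σ Carrier λ x → Σ ℤ λ n → IsPair U x n
  two-elements⇒pair {U} {g} {h} (_ , avoids) g∈U h∈U h≢g =
    Sum.[ (λ (n , h≡gⁿ) → g , + n , is-pair {U} g∈U h∈U U⊆g,h h≡gⁿ)
        , (λ (n , g≡hⁿ) → h , + n , is-pair {U} h∈U g∈U (λ k → Sum.swap ∘ U⊆g,h k) g≡hⁿ) ]
      (commute⇒∈⟨⟩⊎∈⟨⟩ g h (avoided⇒commute _≟ᴳ_ {U = U} avoids g∈U h∈U))
    where
    U⊆g,h : ∀ k → k ∈ U → k ≡ g ⊎ k ≡ h
    U⊆g,h k k∈U = avoided⇒at-most-two _≟ᴳ_ {U = U} avoids g∈U h∈U k∈U (h≢g ∘ sym)

theorem4p11 : (p q s : ℕ) .{{_ : NonZero p}} .{{_ : NonZero q}} →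
    Prime p → Prime q → p % 2 ≡ 1 → q % 2 ≡ 1 → q < p → p % q ≡ 1 →
    s % p ≢ 1 → (s ^ q) % p ≡ 1 →
    (U : Grp.Subset q p s) → Grp.Saturated q p s U →
    Σ (Grp.Carrier q p s) λ x → Σ ℤ λ n → Grp.IsPair q p s U x n
theorem4p11 p q s p-prime q-prime p-odd q-odd _ _ s≢1 s^q≡1 = saturated⇒pair
  where
  open Grp q p s
  open Metacyclic p q s p-prime q-prime p-odd q-odd s≢1 s^q≡1

  saturated⇒pair : ∀ U → Saturated U → Σ Carrier λ x → Σ ℤ λ n → IsPair U x n
  saturated⇒pair U saturated@(avoidable , _) =
    let g , g∈U = saturated⇒nonempty saturated in
    case ∃? (λ h → (U h Bool.≟ true) ×-dec ¬? (h ≟ᴳ g)) of λ where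
      (yes (h , h∈U , h≢g)) → two-elements⇒pair avoidable g∈U h∈U h≢g
      (no ∄h) → g , + 1 , is-pair {U} {n = 1} g∈U g∈U
        (λ k k∈U → inj₁ (decidable-stable (k ≟ᴳ g) λ k≢g → ∄h (k , k∈U , k≢g)))
        (sym (·-identityʳ g))
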